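{- Let $T$ be a forest. A vertex $v$ of $T$ is skew irrelevant if and only if $v$ can be skew forced by the empty set, i.e., $v$ becomes blue when starting with no blue vertices and repeatedly applying the skew color change rule.
   Context: All graphs are finite, simple, undirected. Skew color change rule: given the current white set $W$, any vertex $u$ (blue or white) may turn a white vertex $w$ blue if $N(u)\cap W=\{w\}$. A skew forcing set is a set $S$ such that starting with exactly $S$ blue, repeated application of the rule makes every vertex blue. A vertex is skew irrelevant if it belongs to no inclusion-minimal skew forcing set. -}

module Defs where

open import Data.Nat using (ℕ; suc)
open import Data.Bool using (Bool; true; false)
open import Data.Fin using (Fin; zero; suc; inject₁; fromℕ)
open import Data.Fin.Subset using (Subset; _∈_; _∉_; _⊆_; _∪_; ⁅_⁆; ⊥; ⊤)
open import Data.Product using (Σ; ∃; _×_; _,_)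
open import Function.Bundles using (_⇔_)
open import Function.Definitions using (Injective)
open import Relation.Nullary using (¬_)
open import Relation.Binary.PropositionalEquality using (_≡_)
open import Relation.Binary.Construct.Closure.ReflexiveTransitive using (Star)

record Graph (n : ℕ) : Set where
  field
    adj   : Fin n → Fin n → Bool
    sym   : ∀ u v → adj u v ≡ adj v u
    irrefl : ∀ v → adj v v ≡ false

open Graph public

record Cycle {n : ℕ} (G : Graph n) : Set where
  field
    k      : ℕ
    c      : Fin (suc (suc (suc k))) → Fin n
    inj    : Injective _≡_ _≡_ c
    path   : ∀ (i : Fin (suc (suc k))) → adj G (c (inject₁ i)) (c (suc i)) ≡ true
    closes : adj G (c (fromℕ (suc (suc k)))) (c zero) ≡ true

IsForest : {n : ℕ} → Graph n → Set
IsForest G = ¬ Cycle G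

-- One application of the skew color change rule: B is the current blue set
-- (so the white set is its complement).  Any vertex u may turn white w blue
-- if w is the unique white neighbour of u.
data SkewStep {n : ℕ} (G : Graph n) : Subset n → Subset n → Set where
  force : ∀ {B} (u w : Fin n) → w ∉ B →
          (∀ x → (adj G u x ≡ true × x ∉ B) ⇔ (x ≡ w)) →
          SkewStep G B (B ∪ ⁅ w ⁆)

SkewReach : {n : ℕ} → Graph n → Subset n → Subset n → Set
SkewReach G = Star (SkewStep G)

IsSkewForcingSet : {n : ℕ} → Graph n → Subset n → Set
IsSkewForcingSet G S = SkewReach G S ⊤

IsMinimalSkewForcingSet : {n : ℕ} → Graph n → Subset n → Set
IsMinimalSkewForcingSet G S =
  IsSkewForcingSet G S × (∀ S' → S' ⊆ S → IsSkewForcingSet G S' → S' ≡ S)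

SkewIrrelevant : {n : ℕ} → Graph n → Fin n → Set
SkewIrrelevant G v = ¬ (∃ λ S → IsMinimalSkewForcingSet G S × v ∈ S)

SkewForcedByEmpty : {n : ℕ} → Graph n → Fin n → Set
SkewForcedByEmpty G v = ∃ λ B → SkewReach G ⊥ B × v ∈ B

-- If the empty set forces v, then from S − v the same forces colour v, so no minimal forcing set
-- S contains v; this holds in every graph.  Conversely, suppose v stays white in the final colouring
-- of ∅, whose white vertices form a fort W.  Call Z a pair fort if every vertex has no or exactly
-- two neighbours in Z.  A pair fort Z ∋ v makes v relevant: intersecting Z with the final
-- colouring of ∁ Z ∪ ⁅ v ⁆ keeps it a pair fort, so we may assume ∁ Z ∪ ⁅ v ⁆ is forcing; as every
-- forcing set meets the fort Z, each of its minimal forcing subsets contains v.  In a forest, a pair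
-- fort containing v is cut out of W by pruning leaves other than v of the subforest spanned by W and
-- the vertices with at least two neighbours in W; a leaf exists because non-backtracking walks in a
-- forest never revisit a vertex.
module Submission where

open import Defs hiding (sym)
open import Data.Bool using (true)
import Data.Bool.Properties as Bool
open import Data.Empty using (⊥-elim)
open import Data.Fin using (Fin; zero; suc; toℕ; _≟_) renaming (_<_ to _<ᶠ_)
import Data.Fin.Properties as Fin
open import Data.Fin.Subset
  using (Subset; _∈_; _∉_; _⊆_; _⊂_; _⊃_; _∪_; _∩_; _─_; _-_; ∁; ⁅_⁆; ⊥; ⊤)
open import Data.Fin.Subset.Induction using (⊂-wellFounded; ⊃-wellFounded)
open import Data.Fin.Subset.Properties
  using ( _∈?_; ∈⊤; ∉⊥; ⊆-antisym; x∈p∪q⁺; x∈p∪q⁻; x∈⁅x⁆; x∈⁅y⁆⇒x≡y; p⊆p∪q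
        ; x∈p∩q⁺; x∈p∩q⁻; x∈p⇒x∉∁p; x∈∁p⇒x∉p; x∉∁p⇒x∈p; x∉p⇒x∈∁p
        ; x∈p∧x≢y⇒x∈p-y; p─q⊆p; x∈p⇒p-x⊂p)
open import Data.Nat using (ℕ; zero; suc; _+_; _∸_; _≤_; _<_; z≤n; s≤s; _≤?_)
open import Data.Nat.Induction using (<-wellFounded)
import Data.Nat.Properties as ℕ
open import Data.Product using (∃; ∃₂; _×_; _,_; proj₁; proj₂)
open import Data.Sum using (_⊎_; inj₁; inj₂; [_,_]′; swap)
open import Data.Vec using (_∷_; tabulate; here; there)
open import Data.Vec.Properties using (lookup∘tabulate; []=⇒lookup; lookup⇒[]=)
open import Function using (_∘_; id)
open import Function.Bundles using (_⇔_; mk⇔; Equivalence)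
open import Induction.WellFounded using (Acc; acc)
open import Relation.Binary using (tri<; tri≈; tri>)
open import Relation.Binary.Construct.Closure.ReflexiveTransitive using (ε; _◅_; _◅◅_)
open import Relation.Binary.PropositionalEquality
  using (_≡_; _≢_; refl; sym; trans; cong; subst; ≢-sym)
open import Relation.Nullary using (¬_; Dec; yes; no; does)
open import Relation.Nullary.Decidable using (_×-dec_; _⊎-dec_; _→-dec_; ¬?)
open import Relation.Unary using (Decidable)

all-or-exists : ∀ {n} {P Q : Fin n → Set} → (∀ x → P x ⊎ Q x) → (∀ x → P x) ⊎ ∃ Q
all-or-exists {zero} _ = inj₁ λ ()
all-or-exists {suc n} f with f zero | all-or-exists (f ∘ suc)
... | inj₂ q | _ = inj₂ (zero , q)
... | inj₁ _ | inj₂ (x , q) = inj₂ (suc x , q)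
... | inj₁ p | inj₁ ps = inj₁ λ { zero → p ; (suc x) → ps x }

setOf : ∀ {n} {P : Fin n → Set} → Decidable P → Subset n
setOf P? = tabulate (does ∘ P?)

∈-setOf⁺ : ∀ {n} {P : Fin n → Set} (P? : Decidable P) {x} → P x → x ∈ setOf P?
∈-setOf⁺ {P = P} P? {x} px = lookup⇒[]= x _ (trans (lookup∘tabulate _ x) (accept (P? x)))
  where
  accept : (d : Dec (P x)) → does d ≡ true
  accept (yes _) = refl
  accept (no ¬px) = ⊥-elim (¬px px)

∈-setOf⁻ : ∀ {n} {P : Fin n → Set} (P? : Decidable P) {x} → x ∈ setOf P? → P x
∈-setOf⁻ {P = P} P? {x} x∈ = accepted (P? x) (trans (sym (lookup∘tabulate _ x)) ([]=⇒lookup x∈))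
  where
  accepted : (d : Dec (P x)) → does d ≡ true → P x
  accepted (yes px) _ = px
  accepted (no _) ()

x∈q⇒x∉p─q : ∀ {n} {x : Fin n} (p q : Subset n) → x ∈ q → x ∉ p ─ q
x∈q⇒x∉p─q (_ ∷ _) (_ ∷ _) here ()
x∈q⇒x∉p─q (_ ∷ p) (_ ∷ q) (there x∈q) (there x∈p─q) = x∈q⇒x∉p─q p q x∈q x∈p─q

x∉p-x : ∀ {n} {x : Fin n} (p : Subset n) → x ∉ p - x
x∉p-x {x = x} p = x∈q⇒x∉p─q p ⁅ x ⁆ (x∈⁅x⁆ x)

x∈p∪⁅y⁆⁻ : ∀ {n} {p : Subset n} {x y} → x ∈ p ∪ ⁅ y ⁆ → x ∈ p ⊎ x ≡ y
x∈p∪⁅y⁆⁻ {p = p} {y = y} x∈ with x∈p∪q⁻ p ⁅ y ⁆ x∈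
... | inj₁ x∈p = inj₁ x∈p
... | inj₂ x∈⁅y⁆ = inj₂ (x∈⁅y⁆⇒x≡y y x∈⁅y⁆)

x∉p∪⁅y⁆ : ∀ {n} {p : Subset n} {x y} → x ∉ p → x ≢ y → x ∉ p ∪ ⁅ y ⁆
x∉p∪⁅y⁆ x∉p x≢y = [ x∉p , x≢y ]′ ∘ x∈p∪⁅y⁆⁻

y∈p∪⁅y⁆ : ∀ {n} (p : Subset n) y → y ∈ p ∪ ⁅ y ⁆
y∈p∪⁅y⁆ _ y = x∈p∪q⁺ (inj₂ (x∈⁅x⁆ y))

≡⊤ : ∀ {n} {p : Subset n} → (∀ x → x ∈ p) → p ≡ ⊤
≡⊤ all = ⊆-antisym (λ _ → ∈⊤) (λ {x} _ → all x)

∪⁅⁆-⊆ : ∀ {n} {B B′ : Subset n} {w} → B ⊆ B′ → w ∈ B′ → B ∪ ⁅ w ⁆ ⊆ B′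
∪⁅⁆-⊆ B⊆B′ w∈B′ x∈ with x∈p∪⁅y⁆⁻ x∈
... | inj₁ x∈B = B⊆B′ x∈B
... | inj₂ refl = w∈B′

∪⁅⁆-mono : ∀ {n} {B B′ : Subset n} w → B ⊆ B′ → B ∪ ⁅ w ⁆ ⊆ B′ ∪ ⁅ w ⁆
∪⁅⁆-mono {B′ = B′} w B⊆B′ = ∪⁅⁆-⊆ (x∈p∪q⁺ ∘ inj₁ ∘ B⊆B′) (y∈p∪⁅y⁆ B′ w)

covered-pair : ∀ {A : Set} {a b c d : A} (P : A → Set) → c ≢ d →
  c ≡ a ⊎ c ≡ b → d ≡ a ⊎ d ≡ b → P c → P d → P a × P b
covered-pair P c≢d (inj₁ refl) (inj₁ refl) _ _ = ⊥-elim (c≢d refl)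
covered-pair P c≢d (inj₁ refl) (inj₂ refl) pc pd = pc , pd
covered-pair P c≢d (inj₂ refl) (inj₁ refl) pc pd = pd , pc
covered-pair P c≢d (inj₂ refl) (inj₂ refl) _ _ = ⊥-elim (c≢d refl)

module _ {n : ℕ} (G : Graph n) where

  Adj : Fin n → Fin n → Set
  Adj x y = adj G x y ≡ true

  adj? : ∀ x y → Dec (Adj x y)
  adj? x y = adj G x y Bool.≟ true

  Adj-sym : ∀ {x y} → Adj x y → Adj y x
  Adj-sym {x} {y} = trans (sym (Graph.sym G x y))

  Adj-irrefl : ∀ {x} → ¬ Adj x x
  Adj-irrefl {x} xx with trans (sym xx) (irrefl G x)
  ... | ()

  NbIn : Subset n → Fin n → Fin n → Set
  NbIn Z x y = Adj x y × y ∈ Z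

  nbIn? : ∀ Z x y → Dec (NbIn Z x y)
  nbIn? Z x y = adj? x y ×-dec (y ∈? Z)

  NoNbIn : Subset n → Fin n → Set
  NoNbIn Z x = ∀ y → ¬ NbIn Z x y

  UniqueNbIn : Subset n → Fin n → Fin n → Set
  UniqueNbIn Z x w = NbIn Z x w × (∀ y → NbIn Z x y → y ≡ w)

  TwoNbsIn : Subset n → Fin n → Set
  TwoNbsIn Z x = ∃₂ λ a b → a ≢ b × NbIn Z x a × NbIn Z x b

  ExactlyTwoNbsIn : Subset n → Fin n → Set
  ExactlyTwoNbsIn Z x =
    ∃₂ λ a b → a ≢ b × NbIn Z x a × NbIn Z x b × (∀ y → NbIn Z x y → y ≡ a ⊎ y ≡ b)

  ThreeNbsIn : Subset n → Fin n → Set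
  ThreeNbsIn Z x = ∃₂ λ a b → ∃ λ c →
    a ≢ b × a ≢ c × b ≢ c × NbIn Z x a × NbIn Z x b × NbIn Z x c

  uniqueNbIn? : ∀ Z x w → Dec (UniqueNbIn Z x w)
  uniqueNbIn? Z x w = nbIn? Z x w ×-dec Fin.all? (λ y → nbIn? Z x y →-dec (y ≟ w))

  twoNbs⇒¬uniqueNb : ∀ {Z x w} → TwoNbsIn Z x → ¬ UniqueNbIn Z x w
  twoNbs⇒¬uniqueNb (a , b , a≢b , na , nb) (_ , unique) = a≢b (trans (unique a na) (sym (unique b nb)))

  classify : ∀ Z x → NoNbIn Z x ⊎ ∃ (UniqueNbIn Z x) ⊎ TwoNbsIn Z x
  classify Z x with all-or-exists (λ y → dec (nbIn? Z x y))
    where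
    dec : ∀ {A : Set} → Dec A → ¬ A ⊎ A
    dec (yes a) = inj₂ a
    dec (no ¬a) = inj₁ ¬a
  ... | inj₁ none = inj₁ none
  ... | inj₂ (a , na) with all-or-exists otherThan
    where
    otherThan : ∀ y → (NbIn Z x y → y ≡ a) ⊎ (NbIn Z x y × y ≢ a)
    otherThan y with nbIn? Z x y | y ≟ a
    ... | yes ny | no y≢a = inj₂ (ny , y≢a)
    ... | yes _ | yes y≡a = inj₁ λ _ → y≡a
    ... | no ¬ny | _ = inj₁ (⊥-elim ∘ ¬ny)
  ...   | inj₁ only = inj₂ (inj₁ (a , na , only))
  ...   | inj₂ (b , nb , b≢a) = inj₂ (inj₂ (a , b , ≢-sym b≢a , na , nb))

  exactlyTwo-or-three : ∀ {Z x} → TwoNbsIn Z x → ExactlyTwoNbsIn Z x ⊎ ThreeNbsIn Z x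
  exactlyTwo-or-three {Z} {x} (a , b , a≢b , na , nb) with all-or-exists otherThan
    where
    otherThan : ∀ y → (NbIn Z x y → y ≡ a ⊎ y ≡ b) ⊎ (NbIn Z x y × y ≢ a × y ≢ b)
    otherThan y with nbIn? Z x y | y ≟ a | y ≟ b
    ... | yes ny | no y≢a | no y≢b = inj₂ (ny , y≢a , y≢b)
    ... | yes _ | yes y≡a | _ = inj₁ λ _ → inj₁ y≡a
    ... | yes _ | no _ | yes y≡b = inj₁ λ _ → inj₂ y≡b
    ... | no ¬ny | _ | _ = inj₁ (⊥-elim ∘ ¬ny)
  ... | inj₁ only = inj₁ (a , b , a≢b , na , nb , only)
  ... | inj₂ (c , nc , c≢a , c≢b) = inj₂ (a , b , c , a≢b , ≢-sym c≢a , ≢-sym c≢b , na , nb , nc)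

  threeNbs⇒twoNbs : ∀ {Z x} → ThreeNbsIn Z x → TwoNbsIn Z x
  threeNbs⇒twoNbs (a , b , _ , a≢b , _ , _ , na , nb , _) = a , b , a≢b , na , nb

  otherNb : ∀ {Z x ℓ} → ExactlyTwoNbsIn Z x → NbIn Z x ℓ →
    ∃ λ a → a ≢ ℓ × NbIn Z x a × (∀ y → NbIn Z x y → y ≡ ℓ ⊎ y ≡ a)
  otherNb (a , b , a≢b , na , nb , only) nℓ with only _ nℓ
  ... | inj₁ refl = b , a≢b ∘ sym , nb , only
  ... | inj₂ refl = a , a≢b , na , λ y → swap ∘ only y

  twoNbsIn? : ∀ Z x → Dec (TwoNbsIn Z x)
  twoNbsIn? Z x with classify Z x
  ... | inj₁ none = no λ (a , _ , _ , na , _) → none a na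
  ... | inj₂ (inj₁ (_ , unique)) = no λ two → twoNbs⇒¬uniqueNb two unique
  ... | inj₂ (inj₂ two) = yes two

  AgreeAround : Subset n → Subset n → Fin n → Set
  AgreeAround Z Z′ x = ∀ y → Adj x y → (y ∈ Z → y ∈ Z′) × (y ∈ Z′ → y ∈ Z)

  nbIn-transport : ∀ {Z Z′ x y} → AgreeAround Z Z′ x → NbIn Z x y → NbIn Z′ x y
  nbIn-transport agree (xy , y∈Z) = xy , proj₁ (agree _ xy) y∈Z

  agreeAround-sym : ∀ {Z Z′ x} → AgreeAround Z Z′ x → AgreeAround Z′ Z x
  agreeAround-sym agree y xy = proj₂ (agree y xy) , proj₁ (agree y xy)

  uniqueNbIn-transport : ∀ {Z Z′ x w} → AgreeAround Z Z′ x → UniqueNbIn Z x w → UniqueNbIn Z′ x w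
  uniqueNbIn-transport agree (nw , unique) =
    nbIn-transport agree nw , λ y ny → unique y (nbIn-transport (agreeAround-sym agree) ny)

  IsFort : Subset n → Set
  IsFort F = ∀ x w → ¬ UniqueNbIn F x w

  Force : Subset n → Fin n → Fin n → Set
  Force B = UniqueNbIn (∁ B)

  IsStalled : Subset n → Set
  IsStalled B = IsFort (∁ B)

  fort⇒∁-stalled : ∀ {F} → IsFort F → IsStalled (∁ F)
  fort⇒∁-stalled fort x w =
    fort x w ∘ uniqueNbIn-transport λ _ _ → x∉∁p⇒x∈p ∘ x∈∁p⇒x∉p , x∉p⇒x∈∁p ∘ x∈p⇒x∉∁p

  force⇒step : ∀ {B u w} → Force B u w → SkewStep G B (B ∪ ⁅ w ⁆)
  force⇒step {u = u} {w} ((uw , w∈∁B) , unique) =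
    force u w (x∈∁p⇒x∉p w∈∁B)
      (λ x → mk⇔ (λ (ux , x∉B) → unique x (ux , x∉p⇒x∈∁p x∉B)) λ { refl → uw , x∈∁p⇒x∉p w∈∁B })

  step⇒force : ∀ {B C} → SkewStep G B C → ∃₂ λ u w → Force B u w × C ≡ B ∪ ⁅ w ⁆
  step⇒force (force u w w∉B rule) =
    u , w , ((proj₁ (Equivalence.from (rule w) refl) , x∉p⇒x∈∁p w∉B) ,
             λ y (uy , y∈∁B) → Equivalence.to (rule y) (uy , x∈∁p⇒x∉p y∈∁B)) , refl

  reach-⊆ : ∀ {B C} → SkewReach G B C → B ⊆ C
  reach-⊆ ε = id
  reach-⊆ (force _ _ _ _ ◅ r) = reach-⊆ r ∘ x∈p∪q⁺ ∘ inj₁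

  force-⊆ : ∀ {B B′ u w} → Force B u w → B ⊆ B′ → w ∉ B′ → Force B′ u w
  force-⊆ ((uw , _) , unique) B⊆B′ w∉B′ =
    (uw , x∉p⇒x∈∁p w∉B′) , λ y (uy , y∈∁B′) → unique y (uy , x∉p⇒x∈∁p (x∈∁p⇒x∉p y∈∁B′ ∘ B⊆B′))

  reach-monotone : ∀ {B C B′} → SkewReach G B C → B ⊆ B′ → ∃ λ C′ → SkewReach G B′ C′ × C ⊆ C′
  reach-monotone {B′ = B′} ε B⊆B′ = B′ , ε , B⊆B′
  reach-monotone {B′ = B′} (step ◅ r) B⊆B′ with step⇒force step
  ... | u , w , f , refl with w ∈? B′
  ...   | yes w∈B′ = reach-monotone r (∪⁅⁆-⊆ B⊆B′ w∈B′)
  ...   | no w∉B′ =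
    let C′ , r′ , C⊆C′ = reach-monotone r (∪⁅⁆-mono w B⊆B′)
    in C′ , force⇒step (force-⊆ f B⊆B′ w∉B′) ◅ r′ , C⊆C′

  reach-stalled : ∀ {B C B′} → SkewReach G B C → B ⊆ B′ → IsStalled B′ → C ⊆ B′
  reach-stalled ε B⊆B′ _ = B⊆B′
  reach-stalled {B′ = B′} (step ◅ r) B⊆B′ stalled with step⇒force step
  ... | u , w , f , refl with w ∈? B′
  ...   | yes w∈B′ = reach-stalled r (∪⁅⁆-⊆ B⊆B′ w∈B′) stalled
  ...   | no w∉B′ = ⊥-elim (stalled u w (force-⊆ f B⊆B′ w∉B′))

  forcing-⊆ : ∀ {S S′} → IsSkewForcingSet G S → S ⊆ S′ → IsSkewForcingSet G S′
  forcing-⊆ forcing S⊆S′ with reach-monotone forcing S⊆S′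
  ... | C′ , r , ⊤⊆C′ = subst (SkewReach G _) (≡⊤ λ _ → ⊤⊆C′ ∈⊤) r

  saturate : ∀ B → Acc _⊃_ B → ∃ λ C → SkewReach G B C × IsStalled C
  saturate B (acc rec) with Fin.any? (λ u → Fin.any? (λ w → uniqueNbIn? (∁ B) u w))
  ... | no stalled = B , ε , λ u w f → stalled (u , w , f)
  ... | yes (u , w , f@((_ , w∈∁B) , _)) with saturate (B ∪ ⁅ w ⁆) (rec grows)
    where
    grows : B ⊂ B ∪ ⁅ w ⁆
    grows = p⊆p∪q ⁅ w ⁆ , w , y∈p∪⁅y⁆ B w , x∈∁p⇒x∉p w∈∁B
  ...   | C , r , stalled = C , force⇒step f ◅ r , stalled

  finalColouring : ∀ B → ∃ λ C → SkewReach G B C × IsStalled C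
  finalColouring B = saturate B (⊃-wellFounded B)

  forcing? : ∀ S → Dec (IsSkewForcingSet G S)
  forcing? S with finalColouring S
  ... | C , r , stalled with Fin.all? (_∈? C)
  ...   | yes all = yes (subst (SkewReach G S) (≡⊤ all) r)
  ...   | no ¬all = no λ forcing → ¬all λ x → reach-stalled forcing (reach-⊆ r) stalled ∈⊤

  forcing-meets-fort : ∀ {S F x} → IsSkewForcingSet G S → IsFort F → x ∈ F → ∃ λ y → y ∈ S × y ∈ F
  forcing-meets-fort {S} {F} {x} forcing fort x∈F with Fin.any? (λ y → (y ∈? S) ×-dec (y ∈? F))
  ... | yes meet = meet
  ... | no disjoint = ⊥-elim (x∈p⇒x∉∁p x∈F (reach-stalled forcing S⊆∁F (fort⇒∁-stalled fort) ∈⊤))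
    where
    S⊆∁F : S ⊆ ∁ F
    S⊆∁F {y} y∈S = x∉p⇒x∈∁p λ y∈F → disjoint (y , y∈S , y∈F)

  minimal-if-irredundant : ∀ {S} → IsSkewForcingSet G S →
    (∀ y → y ∈ S → ¬ IsSkewForcingSet G (S - y)) → IsMinimalSkewForcingSet G S
  minimal-if-irredundant {S} forcing irredundant =
    forcing , λ S′ S′⊆S forcing′ → ⊆-antisym S′⊆S (S⊆ forcing′ S′⊆S)
    where
    S⊆ : ∀ {S′} → IsSkewForcingSet G S′ → S′ ⊆ S → S ⊆ S′
    S⊆ {S′} forcing′ S′⊆S {y} y∈S with y ∈? S′
    ... | yes y∈S′ = y∈S′
    ... | no y∉S′ = ⊥-elim (irredundant y y∈S (forcing-⊆ forcing′ λ x∈S′ →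
                      x∈p∧x≢y⇒x∈p-y (S′⊆S x∈S′) λ { refl → y∉S′ x∈S′ }))

  minimalForcingSubset : ∀ S → Acc _⊂_ S → IsSkewForcingSet G S →
    ∃ λ S* → S* ⊆ S × IsMinimalSkewForcingSet G S*
  minimalForcingSubset S (acc rec) forcing with Fin.any? (λ y → (y ∈? S) ×-dec forcing? (S - y))
  ... | no irredundant = S , id , minimal-if-irredundant forcing λ y y∈S f → irredundant (y , y∈S , f)
  ... | yes (y , y∈S , forcing′) with minimalForcingSubset (S - y) (rec (x∈p⇒p-x⊂p y∈S)) forcing′
  ...   | S* , S*⊆ , minimal = S* , p─q⊆p S ⁅ y ⁆ ∘ S*⊆ , minimal

  -- The forces that colour v from ∅ can be replayed from S − v.
  forcedByEmpty⇒irrelevant : ∀ v → SkewForcedByEmpty G v → SkewIrrelevant G v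
  forcedByEmpty⇒irrelevant v (B , r , v∈B) (S , (forcing , minimal) , v∈S)
    with reach-monotone r (⊥-elim ∘ ∉⊥)
  ... | C , r′ , B⊆C = x∉p-x S (subst (v ∈_) (sym S-v≡S) v∈S)
    where
    S⊆C : S ⊆ C
    S⊆C {x} x∈S with x ≟ v
    ... | yes refl = B⊆C v∈B
    ... | no x≢v = reach-⊆ r′ (x∈p∧x≢y⇒x∈p-y x∈S x≢v)
    S-v≡S : S - v ≡ S
    S-v≡S = minimal (S - v) (p─q⊆p S ⁅ v ⁆) (r′ ◅◅ forcing-⊆ forcing S⊆C)

  -- Pair forts

  NoOrTwoNbsIn : Subset n → Fin n → Set
  NoOrTwoNbsIn Z x = NoNbIn Z x ⊎ ExactlyTwoNbsIn Z x

  IsPairFort : Subset n → Set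
  IsPairFort Z = ∀ x → NoOrTwoNbsIn Z x

  pairFort⇒fort : ∀ {Z} → IsPairFort Z → IsFort Z
  pairFort⇒fort pairFort x w unique@(nw , _) with pairFort x
  ... | inj₁ none = none w nw
  ... | inj₂ (a , b , a≢b , na , nb , _) = twoNbs⇒¬uniqueNb (a , b , a≢b , na , nb) unique

  -- Unlike the fort property, having no or exactly two neighbours survives intersecting with a
  -- stalled set C ⊇ ∁ Z: the white neighbours of x lie in Z, so they are none or both of the two.
  pairFort-∩-stalled : ∀ {Z C} → IsPairFort Z → IsStalled C → ∁ Z ⊆ C → IsPairFort (Z ∩ C)
  pairFort-∩-stalled {Z} {C} pairFort stalled ∁Z⊆C x with pairFort x
  ... | inj₁ none = inj₁ λ y (xy , y∈Z∩C) → none y (xy , proj₁ (x∈p∩q⁻ Z C y∈Z∩C))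
  ... | inj₂ (a , b , a≢b , (xa , a∈Z) , (xb , b∈Z) , only) with classify (∁ C) x
  ...   | inj₁ noWhite =
    inj₂ (a , b , a≢b , (xa , x∈p∩q⁺ (a∈Z , blue xa)) , (xb , x∈p∩q⁺ (b∈Z , blue xb)) ,
          λ y (xy , y∈Z∩C) → only y (xy , proj₁ (x∈p∩q⁻ Z C y∈Z∩C)))
    where
    blue : ∀ {y} → Adj x y → y ∈ C
    blue {y} xy = x∉∁p⇒x∈p λ y∈∁C → noWhite y (xy , y∈∁C)
  ...   | inj₂ (inj₁ (w , f)) = ⊥-elim (stalled x w f)
  ...   | inj₂ (inj₂ (c , d , c≢d , (xc , c∈∁C) , (xd , d∈∁C)))
    with covered-pair (_∉ C) c≢d (only c (xc , inZ c∈∁C)) (only d (xd , inZ d∈∁C))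
           (x∈∁p⇒x∉p c∈∁C) (x∈∁p⇒x∉p d∈∁C)
    where
    inZ : ∀ {y} → y ∈ ∁ C → y ∈ Z
    inZ y∈∁C = x∉∁p⇒x∈p λ y∈∁Z → x∈∁p⇒x∉p y∈∁C (∁Z⊆C y∈∁Z)
  ...     | a∉C , b∉C = inj₁ λ y (xy , y∈Z∩C) → notBoth (only y (xy , proj₁ (x∈p∩q⁻ Z C y∈Z∩C)))
                                                   (proj₂ (x∈p∩q⁻ Z C y∈Z∩C))
    where
    notBoth : ∀ {y} → y ≡ a ⊎ y ≡ b → y ∉ C
    notBoth (inj₁ refl) = a∉C
    notBoth (inj₂ refl) = b∉C

  shrinkToForcing : ∀ {v} Z → Acc _⊂_ Z → IsPairFort Z → v ∈ Z →
    ∃ λ Z* → IsPairFort Z* × v ∈ Z* × IsSkewForcingSet G (∁ Z* ∪ ⁅ v ⁆)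
  shrinkToForcing {v} Z (acc rec) pairFort v∈Z with finalColouring (∁ Z ∪ ⁅ v ⁆)
  ... | C , r , stalled with Fin.all? (_∈? C)
  ...   | yes all = Z , pairFort , v∈Z , subst (SkewReach G _) (≡⊤ all) r
  ...   | no ¬all with Fin.¬∀⟶∃¬ n _ (_∈? C) ¬all
  ...     | l , l∉C = shrinkToForcing (Z ∩ C) (rec shrinks)
                        (pairFort-∩-stalled pairFort stalled (∁Z⊆C ∘ x∈p∪q⁺ ∘ inj₁))
                        (x∈p∩q⁺ (v∈Z , ∁Z⊆C (y∈p∪⁅y⁆ (∁ Z) v)))
    where
    ∁Z⊆C : ∁ Z ∪ ⁅ v ⁆ ⊆ C
    ∁Z⊆C = reach-⊆ r
    shrinks : Z ∩ C ⊂ Z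
    shrinks = proj₁ ∘ x∈p∩q⁻ Z C , l , x∉∁p⇒x∈p (l∉C ∘ ∁Z⊆C ∘ x∈p∪q⁺ ∘ inj₁) , l∉C ∘ proj₂ ∘ x∈p∩q⁻ Z C

  -- v is the only vertex of the fort Z* in ∁ Z* ∪ ⁅ v ⁆, so every forcing subset must keep it.
  pairFort⇒relevant : ∀ {Z v} → IsPairFort Z → v ∈ Z → ∃ λ S → IsMinimalSkewForcingSet G S × v ∈ S
  pairFort⇒relevant {Z} pairFort v∈Z with shrinkToForcing Z (⊂-wellFounded Z) pairFort v∈Z
  ... | Z* , pairFort* , v∈Z* , forcing with minimalForcingSubset _ (⊂-wellFounded _) forcing
  ...   | S , S⊆ , minimal with forcing-meets-fort (proj₁ minimal) (pairFort⇒fort pairFort*) v∈Z*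
  ...     | y , y∈S , y∈Z* with x∈p∪⁅y⁆⁻ (S⊆ y∈S)
  ...       | inj₁ y∈∁Z* = ⊥-elim (x∈∁p⇒x∉p y∈∁Z* y∈Z*)
  ...       | inj₂ refl = S , minimal , y∈S

  -- The vertices in I are exempt: they are neighbours of pruned leaves, repaired by reattach.
  IsFortOutside : Subset n → Subset n → Set
  IsFortOutside I A = ∀ x → x ∉ I → ∀ w → ¬ UniqueNbIn A x w

  IsPairFortOutside : Subset n → Subset n → Set
  IsPairFortOutside I Z = ∀ x → x ∉ I → NoOrTwoNbsIn Z x

  agree-remove : ∀ {A ℓ x} → ¬ Adj x ℓ → AgreeAround A (A - ℓ) x
  agree-remove x≁ℓ y xy = (λ y∈A → x∈p∧x≢y⇒x∈p-y y∈A λ { refl → x≁ℓ xy }) , p─q⊆p _ _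

  agree-insert : ∀ {Z ℓ x} → ¬ Adj x ℓ → AgreeAround Z (Z ∪ ⁅ ℓ ⁆) x
  agree-insert x≁ℓ y xy = x∈p∪q⁺ ∘ inj₁ , λ y∈ → [ id , (λ { refl → ⊥-elim (x≁ℓ xy) }) ]′ (x∈p∪⁅y⁆⁻ y∈)

  noOrTwoNbsIn-transport : ∀ {Z Z′ x} → AgreeAround Z Z′ x → NoOrTwoNbsIn Z x → NoOrTwoNbsIn Z′ x
  noOrTwoNbsIn-transport agree (inj₁ none) =
    inj₁ λ y ny → none y (nbIn-transport (agreeAround-sym agree) ny)
  noOrTwoNbsIn-transport agree (inj₂ (a , b , a≢b , na , nb , only)) =
    inj₂ (a , b , a≢b , nbIn-transport agree na , nbIn-transport agree nb ,
          λ y ny → only y (nbIn-transport (agreeAround-sym agree) ny))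

  threeNbs⇒twoNbs-remove : ∀ {A x} ℓ → ThreeNbsIn A x → TwoNbsIn (A - ℓ) x
  threeNbs⇒twoNbs-remove ℓ (a , b , c , a≢b , a≢c , b≢c , (xa , a∈A) , (xb , b∈A) , (xc , c∈A))
    with a ≟ ℓ | b ≟ ℓ
  ... | yes refl | yes refl = ⊥-elim (a≢b refl)
  ... | yes refl | no b≢ℓ = b , c , b≢c , (xb , x∈p∧x≢y⇒x∈p-y b∈A b≢ℓ) , (xc , c∈A-a)
    where c∈A-a = x∈p∧x≢y⇒x∈p-y c∈A (a≢c ∘ sym)
  ... | no a≢ℓ | yes refl = a , c , a≢c , (xa , x∈p∧x≢y⇒x∈p-y a∈A a≢ℓ) , (xc , c∈A-b)
    where c∈A-b = x∈p∧x≢y⇒x∈p-y c∈A (b≢c ∘ sym)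
  ... | no a≢ℓ | no b≢ℓ = a , b , a≢b , (xa , x∈p∧x≢y⇒x∈p-y a∈A a≢ℓ) , (xb , x∈p∧x≢y⇒x∈p-y b∈A b≢ℓ)

  fortOutside-remove : ∀ {I J A ℓ q} → IsFortOutside I A → (∀ x → x ∉ I → x ≢ q → ¬ Adj x ℓ) →
    I ⊆ J → q ∈ J ⊎ TwoNbsIn (A - ℓ) q → IsFortOutside J (A - ℓ)
  fortOutside-remove {q = q} fort farFromℓ I⊆J atQ x x∉J w unique with x ≟ q | atQ
  ... | yes refl | inj₁ q∈J = x∉J q∈J
  ... | yes refl | inj₂ two = twoNbs⇒¬uniqueNb two unique
  ... | no x≢q | _ = fort x x∉I w (uniqueNbIn-transport (agreeAround-sym (agree-remove x≁ℓ)) unique)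
    where
    x∉I = x∉J ∘ I⊆J
    x≁ℓ = farFromℓ x x∉I x≢q

  -- After pruning ℓ the vertex q, whose only other neighbour in A is a, was exempted; putting ℓ
  -- back exactly when a is kept restores no or two neighbours at q and changes nothing elsewhere.
  reattach : ∀ {I A Z ℓ q a} → Z ⊆ A - ℓ → IsPairFortOutside (I ∪ ⁅ q ⁆) Z →
    (∀ x → x ∉ I → x ≢ q → ¬ Adj x ℓ) → ℓ ∈ A → Adj q ℓ → a ≢ ℓ → NbIn A q a →
    (∀ y → NbIn A q y → y ≡ ℓ ⊎ y ≡ a) → ∃ λ Z′ → Z′ ⊆ A × Z ⊆ Z′ × IsPairFortOutside I Z′
  reattach {I} {A} {Z} {ℓ} {q} {a} Z⊆A-ℓ pairFort farFromℓ ℓ∈A qℓ a≢ℓ (qa , a∈A) only with a ∈? Z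
  ... | yes a∈Z = Z ∪ ⁅ ℓ ⁆ , Z∪ℓ⊆A , x∈p∪q⁺ ∘ inj₁ , pairFort′
    where
    Z∪ℓ⊆A : Z ∪ ⁅ ℓ ⁆ ⊆ A
    Z∪ℓ⊆A = ∪⁅⁆-⊆ (p─q⊆p A ⁅ ℓ ⁆ ∘ Z⊆A-ℓ) ℓ∈A
    pairFort′ : IsPairFortOutside I (Z ∪ ⁅ ℓ ⁆)
    pairFort′ x x∉I with x ≟ q
    ... | yes refl = inj₂ (ℓ , a , a≢ℓ ∘ sym , (qℓ , y∈p∪⁅y⁆ Z ℓ) , (qa , x∈p∪q⁺ (inj₁ a∈Z)) ,
                           λ y (qy , y∈) → only y (qy , Z∪ℓ⊆A y∈))
    ... | no x≢q = noOrTwoNbsIn-transport (agree-insert (farFromℓ x x∉I x≢q))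
                     (pairFort x (x∉p∪⁅y⁆ x∉I x≢q))
  ... | no a∉Z = Z , p─q⊆p A ⁅ ℓ ⁆ ∘ Z⊆A-ℓ , id , pairFort′
    where
    pairFort′ : IsPairFortOutside I Z
    pairFort′ x x∉I with x ≟ q
    ... | yes refl = inj₁ λ y (qy , y∈Z) →
      [ (λ { refl → x∉p-x A (Z⊆A-ℓ y∈Z) }) , (λ { refl → a∉Z y∈Z }) ]′
        (only y (qy , p─q⊆p A ⁅ ℓ ⁆ (Z⊆A-ℓ y∈Z)))
    ... | no x≢q = pairFort x (x∉p∪⁅y⁆ x∉I x≢q)

  PairFortWithin : Fin n → Subset n → Subset n → Set
  PairFortWithin v A I = ∃ λ Z → Z ⊆ A × v ∈ Z × IsPairFortOutside I Z

  pruneLeaf : ∀ {v I A ℓ q} → (∀ J → IsFortOutside J (A - ℓ) → PairFortWithin v (A - ℓ) J) →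
    IsFortOutside I A → ℓ ∈ A → Adj ℓ q → (∀ y → y ∉ I → Adj ℓ y → y ≡ q) → PairFortWithin v A I
  pruneLeaf {v} {I} {A} {ℓ} {q} within fort ℓ∈A ℓq onlyQ = atQ (q ∈? I)
    where
    farFromℓ : ∀ x → x ∉ I → x ≢ q → ¬ Adj x ℓ
    farFromℓ x x∉I x≢q xℓ = x≢q (onlyQ x x∉I (Adj-sym xℓ))
    keep : q ∈ I ⊎ TwoNbsIn (A - ℓ) q → PairFortWithin v A I
    keep atQ with within I (fortOutside-remove fort farFromℓ id atQ)
    ... | Z , Z⊆ , v∈Z , pairFort = Z , p─q⊆p A ⁅ ℓ ⁆ ∘ Z⊆ , v∈Z , pairFort
    exempt : ∃ (λ a → a ≢ ℓ × NbIn A q a × (∀ y → NbIn A q y → y ≡ ℓ ⊎ y ≡ a)) → PairFortWithin v A I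
    exempt (a , a≢ℓ , qa , only)
      with within (I ∪ ⁅ q ⁆) (fortOutside-remove fort farFromℓ (p⊆p∪q _) (inj₁ (y∈p∪⁅y⁆ I q)))
    ... | Z , Z⊆ , v∈Z , pairFort with reattach Z⊆ pairFort farFromℓ ℓ∈A (Adj-sym ℓq) a≢ℓ qa only
    ...   | Z′ , Z′⊆A , Z⊆Z′ , pairFort′ = Z′ , Z′⊆A , Z⊆Z′ v∈Z , pairFort′
    atQ : Dec (q ∈ I) → PairFortWithin v A I
    atQ (yes q∈I) = keep (inj₁ q∈I)
    atQ (no q∉I) with classify A q
    ... | inj₁ none = ⊥-elim (none ℓ (Adj-sym ℓq , ℓ∈A))
    ... | inj₂ (inj₁ (w , unique)) = ⊥-elim (fort q q∉I w unique)
    ... | inj₂ (inj₂ two) with exactlyTwo-or-three two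
    ...   | inj₁ exactlyTwo = exempt (otherNb exactlyTwo (Adj-sym ℓq , ℓ∈A))
    ...   | inj₂ three = keep (inj₂ (threeNbs⇒twoNbs-remove ℓ three))

  -- Walks in forests

  IsNBWalk : (ℕ → Fin n) → ℕ → Set
  IsNBWalk f k = (∀ i → i < k → Adj (f i) (f (suc i))) × (∀ i → 2 + i ≤ k → f (2 + i) ≢ f i)

  nbWalk-shift : ∀ {f k} a {L} → IsNBWalk f k → a + L ≤ k → IsNBWalk (λ t → f (a + t)) L
  nbWalk-shift {f} {k} a {L} (step , nonBack) a+L≤k = step′ , nonBack′
    where
    step′ : ∀ i → i < L → Adj (f (a + i)) (f (a + suc i))
    step′ i i<L = subst (Adj (f (a + i)) ∘ f) (sym (ℕ.+-suc a i))
                    (step (a + i) (ℕ.<-≤-trans (ℕ.+-monoʳ-< a i<L) a+L≤k))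
    nonBack′ : ∀ i → 2 + i ≤ L → f (a + (2 + i)) ≢ f (a + i)
    nonBack′ i 2+i≤L = nonBack (a + i) (subst (_≤ k) a+[2+i]≡ (ℕ.≤-trans (ℕ.+-monoʳ-≤ a 2+i≤L) a+L≤k))
                       ∘ subst (λ t → f t ≡ f (a + i)) a+[2+i]≡
      where
      a+[2+i]≡ : a + (2 + i) ≡ 2 + (a + i)
      a+[2+i]≡ = trans (ℕ.+-suc a (suc i)) (cong suc (ℕ.+-suc a i))

  IsClosedNBWalk : (ℕ → Fin n) → ℕ → Set
  IsClosedNBWalk f L = IsNBWalk f L × 0 < L × f 0 ≡ f L

  closedSubwalk : ∀ {f k i j} → IsNBWalk f k → i < j → j ≤ k → f i ≡ f j →
    IsClosedNBWalk (λ t → f (i + t)) (j ∸ i)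
  closedSubwalk {f} {k} {i} {j} walk i<j j≤k fi≡fj =
    nbWalk-shift i walk (subst (_≤ k) (sym i+[j∸i]≡j) j≤k) ,
    ℕ.m<n⇒0<n∸m i<j ,
    trans (cong f (ℕ.+-identityʳ i)) (trans fi≡fj (cong f (sym i+[j∸i]≡j)))
    where
    i+[j∸i]≡j : i + (j ∸ i) ≡ j
    i+[j∸i]≡j = ℕ.m+[n∸m]≡n (ℕ.<⇒≤ i<j)

  extend : (ℕ → Fin n) → ℕ → Fin n → ℕ → Fin n
  extend g k y i with i ≤? k
  ... | yes _ = g i
  ... | no _ = y

  extend-≤ : ∀ g {k} y {i} → i ≤ k → extend g k y i ≡ g i
  extend-≤ g {k} y {i} i≤k with i ≤? k
  ... | yes _ = refl
  ... | no i≰k = ⊥-elim (i≰k i≤k)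

  extend-suc : ∀ g k y → extend g k y (suc k) ≡ y
  extend-suc g k y with suc k ≤? k
  ... | yes 1+k≤k = ⊥-elim (ℕ.<-irrefl refl 1+k≤k)
  ... | no _ = refl

  nbWalk-extend : ∀ {g k y} → IsNBWalk g (suc k) → Adj (g (suc k)) y → y ≢ g k →
    IsNBWalk (extend g (suc k) y) (2 + k)
  nbWalk-extend {g} {k} {y} (step , nonBack) gy y≢gk = step′ , nonBack′
    where
    step′ : ∀ i → i < 2 + k → Adj (extend g (suc k) y i) (extend g (suc k) y (suc i))
    step′ i i<2+k with ℕ.m≤n⇒m<n∨m≡n (ℕ.≤-pred i<2+k)
    ... | inj₁ i<1+k rewrite extend-≤ g y (ℕ.<⇒≤ i<1+k) | extend-≤ g y i<1+k = step i i<1+k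
    ... | inj₂ refl rewrite extend-≤ g y (ℕ.≤-refl {suc k}) | extend-suc g (suc k) y = gy
    nonBack′ : ∀ i → 2 + i ≤ 2 + k → extend g (suc k) y (2 + i) ≢ extend g (suc k) y i
    nonBack′ i 2+i≤2+k with ℕ.m≤n⇒m<n∨m≡n 2+i≤2+k
    ... | inj₁ 2+i<2+k
      rewrite extend-≤ g y (ℕ.≤-pred 2+i<2+k)
            | extend-≤ g y (ℕ.≤-trans (ℕ.m≤n+m i 2) (ℕ.≤-pred 2+i<2+k))
      = nonBack i (ℕ.≤-pred 2+i<2+k)
    ... | inj₂ refl rewrite extend-suc g (suc k) y | extend-≤ g y (ℕ.n≤1+n i) = y≢gk

  extend-∈ : ∀ {S g k y} → (∀ i → i ≤ k → g i ∈ S) → y ∈ S → ∀ i → i ≤ suc k → extend g k y i ∈ S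
  extend-∈ {S} {g} {k} {y} g∈S y∈S i i≤1+k with ℕ.m≤n⇒m<n∨m≡n i≤1+k
  ... | inj₁ i<1+k = subst (_∈ S) (sym (extend-≤ g y (ℕ.≤-pred i<1+k))) (g∈S i (ℕ.≤-pred i<1+k))
  ... | inj₂ refl = subst (_∈ S) (sym (extend-suc g k y)) y∈S

  windowCycle : (f : ℕ → Fin n) (m : ℕ) →
    (∀ (a b : Fin (3 + m)) → f (toℕ a) ≡ f (toℕ b) → a ≡ b) →
    (∀ i → i < 2 + m → Adj (f i) (f (suc i))) → Adj (f (2 + m)) (f 0) → Cycle G
  windowCycle f m injective step closes = record
    { k = m
    ; c = f ∘ toℕ
    ; inj = injective _ _
    ; path = λ i → subst (λ t → Adj (f t) (f (suc (toℕ i)))) (sym (Fin.toℕ-inject₁ i))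
                     (step (toℕ i) (Fin.toℕ<n i))
    ; closes = subst (λ t → Adj (f t) (f 0)) (sym (Fin.toℕ-fromℕ (2 + m))) closes
    }

  Leaf : Subset n → Fin n → Fin n → Set
  Leaf S ℓ q = ℓ ∈ S × q ∈ S × Adj ℓ q × (∀ y → y ∈ S → Adj ℓ y → y ≡ q)

  module _ (forest : IsForest G) where

    -- A shortest closed subwalk has distinct vertices; non-backtracking makes it a cycle.
    noClosedNBWalk : ∀ L → Acc _<_ L → ∀ f → ¬ IsClosedNBWalk f L
    noClosedNBWalk L (acc rec) f closed@(walk , _)
      with Fin.any? (λ (a : Fin L) → Fin.any? (λ b → (a Fin.<? b) ×-dec (f (toℕ a) ≟ f (toℕ b))))
    ... | yes (a , b , a<b , fa≡fb) =
      noClosedNBWalk (toℕ b ∸ toℕ a)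
        (rec (ℕ.≤-<-trans (ℕ.m∸n≤m (toℕ b) (toℕ a)) (Fin.toℕ<n b))) _
        (closedSubwalk walk a<b (ℕ.<⇒≤ (Fin.toℕ<n b)) fa≡fb)
    ... | no distinct = window L distinct closed
      where
      window : ∀ L → ¬ (∃₂ λ (a b : Fin L) → a <ᶠ b × f (toℕ a) ≡ f (toℕ b)) → ¬ IsClosedNBWalk f L
      window 1 _ ((step , _) , _ , f0≡f1) = Adj-irrefl (subst (Adj (f 0)) (sym f0≡f1) (step 0 (s≤s z≤n)))
      window 2 _ ((_ , nonBack) , _ , f0≡f2) = nonBack 0 ℕ.≤-refl (sym f0≡f2)
      window (suc (suc (suc m))) distinct ((step , _) , _ , f0≡fL) =
        forest (windowCycle f m injective (λ i i<2+m → step i (ℕ.m<n⇒m<1+n i<2+m))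
                 (subst (Adj (f (2 + m))) (sym f0≡fL) (step (2 + m) ℕ.≤-refl)))
        where
        injective : ∀ (a b : Fin (3 + m)) → f (toℕ a) ≡ f (toℕ b) → a ≡ b
        injective a b fa≡fb with Fin.<-cmp a b
        ... | tri< a<b _ _ = ⊥-elim (distinct (a , b , a<b , fa≡fb))
        ... | tri≈ _ a≡b _ = a≡b
        ... | tri> _ _ b<a = ⊥-elim (distinct (b , a , b<a , sym fa≡fb))

    nbWalk-injective : ∀ {f k} → IsNBWalk f k → ∀ {i j} → i < j → j ≤ k → f i ≢ f j
    nbWalk-injective walk i<j j≤k fi≡fj =
      noClosedNBWalk _ (<-wellFounded _) _ (closedSubwalk walk i<j j≤k fi≡fj)

    -- Extending a non-backtracking walk inside S until it gets stuck ends at a leaf of S; the fuel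
    -- cannot run out, as the walk never revisits a vertex.
    walkToLeaf : ∀ {S} fuel k → n ≤ fuel + suc k → (g : ℕ → Fin n) → IsNBWalk g (suc k) →
      (∀ i → i ≤ suc k → g i ∈ S) → ∃₂ λ ℓ q → Leaf S ℓ q × ℓ ≢ g 0
    walkToLeaf zero k n≤1+k g walk _ with Fin.pigeonhole (ℕ.n<1+n n) (g ∘ toℕ)
    ... | i , j , i<j , gi≡gj =
      ⊥-elim (nbWalk-injective walk i<j (ℕ.≤-trans (ℕ.≤-pred (Fin.toℕ<n j)) n≤1+k) gi≡gj)
    walkToLeaf {S} (suc fuel) k n≤fuel+2+k g walk@(step , _) g∈S
      with Fin.any? (λ y → (y ∈? S) ×-dec adj? (g (suc k)) y ×-dec ¬? (y ≟ g k))
    ... | no stuck = g (suc k) , g k , leaf , ≢-sym (nbWalk-injective walk (s≤s z≤n) ℕ.≤-refl)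
      where
      onlyBack : ∀ y → y ∈ S → Adj (g (suc k)) y → y ≡ g k
      onlyBack y y∈S gy with y ≟ g k
      ... | yes y≡gk = y≡gk
      ... | no y≢gk = ⊥-elim (stuck (y , y∈S , gy , y≢gk))
      leaf : Leaf S (g (suc k)) (g k)
      leaf = g∈S (suc k) ℕ.≤-refl , g∈S k (ℕ.n≤1+n k) , Adj-sym (step k ℕ.≤-refl) , onlyBack
    ... | yes (y , y∈S , gy , y≢gk) =
      let ℓ , q , leaf , ℓ≢g′0 =
            walkToLeaf fuel (suc k) (subst (n ≤_) (sym (ℕ.+-suc fuel (suc k))) n≤fuel+2+k)
              (extend g (suc k) y) (nbWalk-extend walk gy y≢gk) (extend-∈ g∈S y∈S)
      in ℓ , q , leaf , ℓ≢g′0 ∘ λ ℓ≡g0 → trans ℓ≡g0 (sym (extend-≤ g {suc k} y z≤n))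

    leafAwayFrom : ∀ {S p c} → p ∈ S → c ∈ S → Adj p c → ∃₂ λ ℓ q → Leaf S ℓ q × ℓ ≢ p
    leafAwayFrom {S} {p} {c} p∈S c∈S pc =
      walkToLeaf n 0 (ℕ.m≤m+n n 1) edge ((λ { 0 _ → pc ; (suc _) (s≤s ()) }) , λ { _ (s≤s ()) }) edge∈S
      where
      edge : ℕ → Fin n
      edge zero = p
      edge (suc _) = c
      edge∈S : ∀ i → i ≤ 1 → edge i ∈ S
      edge∈S zero _ = p∈S
      edge∈S (suc _) _ = c∈S

    -- Walking from a first leaf gives a second one, so one of them avoids v.
    leafAvoiding : ∀ {S p c} → p ∈ S → c ∈ S → Adj p c → ∀ v → ∃₂ λ ℓ q → Leaf S ℓ q × ℓ ≢ v
    leafAvoiding p∈S c∈S pc v with leafAwayFrom p∈S c∈S pc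
    ... | ℓ , q , leaf@(ℓ∈S , q∈S , ℓq , _) , _ with ℓ ≟ v
    ...   | no ℓ≢v = ℓ , q , leaf , ℓ≢v
    ...   | yes refl = leafAwayFrom ℓ∈S q∈S ℓq

    -- ℓ is a leaf of the forest induced on A together with the non-exempt vertices having two
    -- neighbours in A; every non-exempt neighbour of ℓ ∈ A has one in A, hence two, hence is q.
    prunableLeaf : ∀ {I A x₀} v → IsFortOutside I A → x₀ ∉ I → TwoNbsIn A x₀ →
      ∃₂ λ ℓ q → ℓ ∈ A × ℓ ≢ v × Adj ℓ q × (∀ y → y ∉ I → Adj ℓ y → y ≡ q)
    prunableLeaf {I} {A} v fort x₀∉I two₀@(a , _ , _ , (x₀a , a∈A) , _) =
      let ℓ , q , leaf , ℓ≢v = leafAvoiding (inS (inj₂ (x₀∉I , two₀))) (inS (inj₁ a∈A)) x₀a v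
          ℓ∈A , ℓq , onlyQ = prunable leaf
      in ℓ , q , ℓ∈A , ℓ≢v , ℓq , onlyQ
      where
      S? : Decidable (λ x → x ∈ A ⊎ (x ∉ I × TwoNbsIn A x))
      S? x = (x ∈? A) ⊎-dec (¬? (x ∈? I) ×-dec twoNbsIn? A x)
      inS : ∀ {x} → x ∈ A ⊎ (x ∉ I × TwoNbsIn A x) → x ∈ setOf S?
      inS = ∈-setOf⁺ S?
      prunable : ∀ {ℓ q} → Leaf (setOf S?) ℓ q → ℓ ∈ A × Adj ℓ q × (∀ y → y ∉ I → Adj ℓ y → y ≡ q)
      prunable {ℓ} {q} (ℓ∈S , _ , ℓq , onlyQ) = ℓ∈A , ℓq , onlyQ′
        where
        ℓ∈A : ℓ ∈ A
        ℓ∈A with ∈-setOf⁻ S? ℓ∈S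
        ... | inj₁ ℓ∈A = ℓ∈A
        ... | inj₂ (_ , b , c , b≢c , (ℓb , b∈A) , (ℓc , c∈A)) =
          ⊥-elim (b≢c (trans (onlyQ b (inS (inj₁ b∈A)) ℓb) (sym (onlyQ c (inS (inj₁ c∈A)) ℓc))))
        onlyQ′ : ∀ y → y ∉ I → Adj ℓ y → y ≡ q
        onlyQ′ y y∉I ℓy with classify A y
        ... | inj₁ none = ⊥-elim (none ℓ (Adj-sym ℓy , ℓ∈A))
        ... | inj₂ (inj₁ (w , unique)) = ⊥-elim (fort y y∉I w unique)
        ... | inj₂ (inj₂ two) = onlyQ y (inS (inj₂ (y∉I , two))) ℓy

    pairFortWithin : ∀ {v} A → Acc _⊂_ A → ∀ I → IsFortOutside I A → v ∈ A → PairFortWithin v A I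
    pairFortWithin {v} A (acc rec) I fort v∈A with all-or-exists defect
      where
      defect : ∀ x → (x ∉ I → NoOrTwoNbsIn A x) ⊎ (x ∉ I × ThreeNbsIn A x)
      defect x with x ∈? I
      ... | yes x∈I = inj₁ λ x∉I → ⊥-elim (x∉I x∈I)
      ... | no x∉I with classify A x
      ...   | inj₁ none = inj₁ λ _ → inj₁ none
      ...   | inj₂ (inj₁ (w , unique)) = ⊥-elim (fort x x∉I w unique)
      ...   | inj₂ (inj₂ two) =
        [ (λ exactlyTwo → inj₁ λ _ → inj₂ exactlyTwo) , (λ three → inj₂ (x∉I , three)) ]′
          (exactlyTwo-or-three two)
    ... | inj₁ pairFort = A , id , v∈A , pairFort
    ... | inj₂ (x₀ , x₀∉I , three) =
      let ℓ , q , ℓ∈A , ℓ≢v , ℓq , onlyQ = prunableLeaf v fort x₀∉I (threeNbs⇒twoNbs three)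
      in pruneLeaf (λ J fort′ → pairFortWithin (A - ℓ) (rec (x∈p⇒p-x⊂p ℓ∈A)) J fort′
                                  (x∈p∧x≢y⇒x∈p-y v∈A (≢-sym ℓ≢v)))
                   fort ℓ∈A ℓq onlyQ

    irrelevant⇒forcedByEmpty : ∀ v → SkewIrrelevant G v → SkewForcedByEmpty G v
    irrelevant⇒forcedByEmpty v irrelevant with finalColouring ⊥
    ... | C , r , stalled with v ∈? C
    ...   | yes v∈C = C , r , v∈C
    ...   | no v∉C with pairFortWithin (∁ C) (⊂-wellFounded _) ⊥ (λ x _ → stalled x) (x∉p⇒x∈∁p v∉C)
    ...     | Z , _ , v∈Z , pairFort = ⊥-elim (irrelevant (pairFort⇒relevant (λ x → pairFort x ∉⊥) v∈Z))

proposition5p13 : (n : ℕ) (T : Graph n) → IsForest T →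
    (v : Fin n) → SkewIrrelevant T v ⇔ SkewForcedByEmpty T v
proposition5p13 n T forest v = mk⇔ (irrelevant⇒forcedByEmpty T forest v) (forcedByEmpty⇒irrelevant T v)
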